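{- Let $k\ge 2$ and let $p=(p_1,\dots,p_k)$ and $q=(q_1,\dots,q_k)$ be arrays of positive integers with $p\prec q$ (so in particular $p_1+\dots+p_k=q_1+\dots+q_k$). Then $H(S(p_1,\dots,p_k))\ge H(S(q_1,\dots,q_k))$.
   Context: The Harary index of a connected graph $G$ is $H(G)=\sum_{\{x,y\}\subseteq V(G),\,x\ne y}\frac{1}{d(x,y)}$, $d$ the shortest-path distance. For positive integers $n_1\ge n_2\ge\dots\ge n_k$, $S(n_1,\dots,n_k)$ denotes the tree consisting of a vertex $v$ such that $S(n_1,\dots,n_k)-v$ is the disjoint union of paths $P_{n_1},\dots,P_{n_k}$ on $n_1,\dots,n_k$ vertices, with $v$ adjacent to an endvertex of each path; it has $n_1+\dots+n_k+1$ vertices. For integer arrays $x=(x_1,\dots,x_k)$, $y=(y_1,\dots,y_k)$, $x$ majorizes $y$, written $x\succ y$ (equivalently $y\prec x$), if $x_1\ge\dots\ge x_k$, $y_1\ge\dots\ge y_k$, $x_1+\dots+x_j\ge y_1+\dots+y_j$ for every $1\le j<k$, and $x_1+\dots+x_k=y_1+\dots+y_k$. -}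

module Defs where

open import Data.Nat as ℕ using (ℕ; zero; suc; _+_; _≤_; _<_; _≡ᵇ_; _∸_)
open import Data.Bool using (Bool; true; false; _∧_; _∨_; if_then_else_)
open import Data.List as List using (List; []; _∷_; _++_; upTo; concatMap)
open import Data.Vec as Vec using (Vec; toList)
open import Data.Integer using (+_)
open import Data.Rational as ℚ using (ℚ; _/_)
open import Data.Fin using (Fin; toℕ)
open import Data.Nat.ListAction using () renaming (sum to sumL)
open import Data.Product using (_×_; _,_; proj₁; proj₂)
open import Relation.Binary.PropositionalEquality using (_≡_)

record Graph : Set where
  field
    N   : ℕ
    adj : ℕ → ℕ → Bool       -- adjacency (only consulted on vertices < N)
open Graph public

anyV : ℕ → (ℕ → Bool) → Bool
anyV n P = List.foldr (λ v b → P v ∨ b) false (upTo n)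

reach : Graph → ℕ → ℕ → ℕ → Bool
reach G zero    x y = x ≡ᵇ y
reach G (suc m) x y = reach G m x y ∨ anyV (N G) (λ w → reach G m x w ∧ adj G w y)

-- shortest-path distance: least m ≤ N with a walk of length ≤ m from x to y
-- (search from 0 upward; returns 0 if y is unreachable, which never
--  happens in a connected graph; also d(x,x) = 0)
distFrom : Graph → ℕ → ℕ → ℕ → ℕ → ℕ
distFrom G zero    m x y = m
distFrom G (suc f) m x y = if reach G m x y then m else distFrom G f (suc m) x y

dist : Graph → ℕ → ℕ → ℕ
dist G x y = if reach G (N G) x y then distFrom G (N G) 0 x y else 0

-- 1/d as a rational (1/0 := 0, never used for distinct vertices of a
-- connected graph)
inv : ℕ → ℚ
inv zero    = ℚ.0ℚ
inv (suc d) = (+ 1) / suc d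

sumℚ : List ℚ → ℚ
sumℚ = List.foldr ℚ._+_ ℚ.0ℚ

harary : Graph → ℚ
harary G = sumℚ (concatMap (λ y → List.map (λ x → inv (dist G x y)) (upTo y)) (upTo (N G)))

-- The starlike tree S(n₁,…,n_k)
-- Vertex 0 is the centre v.  The i-th path P_{n_i} occupies vertices
-- s+1, …, s+n_i where s = n₁+…+n_{i-1}; vertex s+1 is the endvertex
-- adjacent to v, and s+j ~ s+j+1 for 1 ≤ j < n_i.

pathEdges : ℕ → ℕ → List (ℕ × ℕ)
pathEdges s n = List.map (λ j → (s + suc j , s + suc (suc j))) (upTo (n ∸ 1))

starEdges : ℕ → List ℕ → List (ℕ × ℕ)
starEdges s []       = []
starEdges s (n ∷ ns) = (0 , s + 1) ∷ (pathEdges s n ++ starEdges (s + n) ns)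

edgeAdj : List (ℕ × ℕ) → ℕ → ℕ → Bool
edgeAdj es u v = List.foldr (λ e b → ((proj₁ e ≡ᵇ u) ∧ (proj₂ e ≡ᵇ v)) ∨ ((proj₁ e ≡ᵇ v) ∧ (proj₂ e ≡ᵇ u)) ∨ b) false es

S : ∀ {k} → Vec ℕ k → Graph
S ns = record { N = suc (Vec.sum ns) ; adj = edgeAdj (starEdges 0 (toList ns)) }

prefixSum : ∀ {k} → ℕ → Vec ℕ k → ℕ
prefixSum j xs = sumL (List.take j (toList xs))

Nonincreasing : ∀ {k} → Vec ℕ k → Set
Nonincreasing {k} xs = (i j : Fin k) → toℕ i ≤ toℕ j → Vec.lookup xs j ≤ Vec.lookup xs i

_≻_ : ∀ {k} → Vec ℕ k → Vec ℕ k → Set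
_≻_ {k} x y =
  Nonincreasing x × Nonincreasing y ×
  ((j : ℕ) → 1 ≤ j → j < k → prefixSum j y ≤ prefixSum j x) ×
  Vec.sum x ≡ Vec.sum y

_≺_ : ∀ {k} → Vec ℕ k → Vec ℕ k → Set
y ≺ x = x ≻ y

-- Every distance in S(n₁,…,n_k) is a tree distance, read off from the (branch, depth)
-- coordinates of the two vertices. This gives H(S) in closed form: each path with
-- the centre contributes the Harary index of a path, and each pair of paths of
-- lengths a, b contributes a cross term G(a,b), concave in each argument. Moving one
-- vertex from a path of length a+1 to one of length b ≤ a leaves the path terms
-- unchanged (both sides describe the same path through the centre) and, by
-- concavity, does not decrease the cross terms. If q ≻ p, the surplus of q₁ over p₁
-- is handed, one vertex at a time, to entries of q smaller than p₁; once the first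
-- entries agree the first path is removed, and its cross terms become concave
-- weights on the remaining paths, so the induction runs on the weighted index.

module Submission where

open import Algebra.Bundles using (CommutativeMonoid)
import Algebra.Properties.CommutativeSemigroup as CommutativeSemigroupProperties
open import Data.Rational.Properties using (+-0-commutativeMonoid)

module ℚ+ = CommutativeSemigroupProperties (CommutativeMonoid.commutativeSemigroup +-0-commutativeMonoid)

module Sums where
  open import Defs using (inv; sumℚ; harary; dist; N)
  open import Data.Nat as ℕ using (ℕ; zero; suc)
  import Data.Nat.Properties as ℕP
  open import Data.List as List using (List; []; _∷_; _++_; applyUpTo; concatMap)
  open import Data.Rational using (ℚ; _+_; _≤_; 0ℚ)
  import Data.Rational.Properties as ℚP
  open import Function using (_∘_; id)
  open import Relation.Binary.PropositionalEquality

  ∑ : ℕ → (ℕ → ℚ) → ℚ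
  ∑ zero    f = 0ℚ
  ∑ (suc n) f = ∑ n f + f n

  ∑-cong : ∀ n {f g : ℕ → ℚ} → (∀ i → i ℕ.< n → f i ≡ g i) → ∑ n f ≡ ∑ n g
  ∑-cong zero    f≡g = refl
  ∑-cong (suc n) f≡g = cong₂ _+_ (∑-cong n (λ i i<n → f≡g i (ℕP.m<n⇒m<1+n i<n))) (f≡g n ℕP.≤-refl)

  ∑-mono-≤ : ∀ n {f g : ℕ → ℚ} → (∀ i → f i ≤ g i) → ∑ n f ≤ ∑ n g
  ∑-mono-≤ zero    f≤g = ℚP.≤-refl
  ∑-mono-≤ (suc n) f≤g = ℚP.+-mono-≤ (∑-mono-≤ n f≤g) (f≤g n)

  ∑-zero : ∀ n → ∑ n (λ _ → 0ℚ) ≡ 0ℚ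
  ∑-zero zero    = refl
  ∑-zero (suc n) = cong (_+ 0ℚ) (∑-zero n)

  ∑-distrib-+ : ∀ n (f g : ℕ → ℚ) → ∑ n (λ i → f i + g i) ≡ ∑ n f + ∑ n g
  ∑-distrib-+ zero    f g = sym (ℚP.+-identityʳ 0ℚ)
  ∑-distrib-+ (suc n) f g = begin
    ∑ n (λ i → f i + g i) + (f n + g n)  ≡⟨ cong (_+ (f n + g n)) (∑-distrib-+ n f g) ⟩
    (∑ n f + ∑ n g) + (f n + g n)        ≡⟨ ℚ+.interchange (∑ n f) (∑ n g) (f n) (g n) ⟩
    (∑ n f + f n) + (∑ n g + g n)        ∎
    where open ≡-Reasoning

  ∑-unfoldˡ : ∀ n (f : ℕ → ℚ) → ∑ (suc n) f ≡ f 0 + ∑ n (λ i → f (suc i))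
  ∑-unfoldˡ zero    f = trans (ℚP.+-identityˡ (f 0)) (sym (ℚP.+-identityʳ (f 0)))
  ∑-unfoldˡ (suc n) f = trans (cong (_+ f (suc n)) (∑-unfoldˡ n f))
                              (ℚP.+-assoc (f 0) (∑ n (λ i → f (suc i))) (f (suc n)))

  ∑-+ : ∀ m n (f : ℕ → ℚ) → ∑ (m ℕ.+ n) f ≡ ∑ m f + ∑ n (λ i → f (m ℕ.+ i))
  ∑-+ m zero    f = trans (cong (λ k → ∑ k f) (ℕP.+-identityʳ m)) (sym (ℚP.+-identityʳ (∑ m f)))
  ∑-+ m (suc n) f = begin
    ∑ (m ℕ.+ suc n) f                                ≡⟨ cong (λ k → ∑ k f) (ℕP.+-suc m n) ⟩
    ∑ (m ℕ.+ n) f + f (m ℕ.+ n)                      ≡⟨ cong (_+ f (m ℕ.+ n)) (∑-+ m n f) ⟩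
    (∑ m f + ∑ n (λ i → f (m ℕ.+ i))) + f (m ℕ.+ n)  ≡⟨ ℚP.+-assoc (∑ m f) _ (f (m ℕ.+ n)) ⟩
    ∑ m f + ∑ (suc n) (λ i → f (m ℕ.+ i))            ∎
    where open ≡-Reasoning

  ∑-comm : ∀ m n (f : ℕ → ℕ → ℚ) → ∑ m (λ i → ∑ n (f i)) ≡ ∑ n (λ j → ∑ m (λ i → f i j))
  ∑-comm zero    n f = sym (∑-zero n)
  ∑-comm (suc m) n f = trans (cong (_+ ∑ n (f m)) (∑-comm m n f))
                             (sym (∑-distrib-+ n (λ j → ∑ m (λ i → f i j)) (f m)))

  sumℚ-++ : ∀ xs ys → sumℚ (xs ++ ys) ≡ sumℚ xs + sumℚ ys
  sumℚ-++ []       ys = sym (ℚP.+-identityˡ (sumℚ ys))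
  sumℚ-++ (x ∷ xs) ys = trans (cong (x +_) (sumℚ-++ xs ys)) (sym (ℚP.+-assoc x (sumℚ xs) (sumℚ ys)))

  sumℚ-concatMap-applyUpTo : ∀ n (g : ℕ → ℕ) (h : ℕ → List ℚ) →
                             sumℚ (concatMap h (applyUpTo g n)) ≡ ∑ n (λ i → sumℚ (h (g i)))
  sumℚ-concatMap-applyUpTo zero    g h = refl
  sumℚ-concatMap-applyUpTo (suc n) g h = begin
    sumℚ (h (g 0) ++ concatMap h (applyUpTo (g ∘ suc) n))  ≡⟨ sumℚ-++ (h (g 0)) _ ⟩
    sumℚ (h (g 0)) + sumℚ (concatMap h (applyUpTo (g ∘ suc) n))
      ≡⟨ cong (sumℚ (h (g 0)) +_) (sumℚ-concatMap-applyUpTo n (g ∘ suc) h) ⟩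
    sumℚ (h (g 0)) + ∑ n (λ i → sumℚ (h (g (suc i))))     ≡⟨ ∑-unfoldˡ n (λ i → sumℚ (h (g i))) ⟨
    ∑ (suc n) (λ i → sumℚ (h (g i)))                        ∎
    where open ≡-Reasoning

  sumℚ-map-applyUpTo : ∀ n (g : ℕ → ℕ) (f : ℕ → ℚ) → sumℚ (List.map f (applyUpTo g n)) ≡ ∑ n (f ∘ g)
  sumℚ-map-applyUpTo zero    g f = refl
  sumℚ-map-applyUpTo (suc n) g f =
    trans (cong (f (g 0) +_) (sumℚ-map-applyUpTo n (g ∘ suc) f)) (sym (∑-unfoldˡ n (f ∘ g)))

  harary-∑ : ∀ G → harary G ≡ ∑ (N G) (λ y → ∑ y (λ x → inv (dist G x y)))
  harary-∑ G = trans (sumℚ-concatMap-applyUpTo (N G) id _)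
                     (∑-cong (N G) (λ y _ → sumℚ-map-applyUpTo y id _))

module Booleans where
  open import Data.Nat using (_≡ᵇ_)
  import Data.Nat.Properties as ℕP
  open import Data.Bool using (true; false; _∧_; _∨_)
  open import Data.Bool.Properties using (T-≡)
  open import Data.Product using (_×_; _,_)
  open import Data.Sum using (_⊎_; inj₁; inj₂)
  open import Function using (_∘_; Equivalence)
  open import Relation.Binary.PropositionalEquality

  ≡ᵇ-true⇒≡ : ∀ m n → (m ≡ᵇ n) ≡ true → m ≡ n
  ≡ᵇ-true⇒≡ m n = ℕP.≡ᵇ⇒≡ m n ∘ Equivalence.from T-≡

  ≡ᵇ-refl : ∀ m → (m ≡ᵇ m) ≡ true
  ≡ᵇ-refl m = Equivalence.to T-≡ (ℕP.≡⇒≡ᵇ m m refl)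

  ∨-true⁻ : ∀ a {b} → a ∨ b ≡ true → a ≡ true ⊎ b ≡ true
  ∨-true⁻ true  _ = inj₁ refl
  ∨-true⁻ false e = inj₂ e

  ∧-true⁻ : ∀ a {b} → a ∧ b ≡ true → a ≡ true × b ≡ true
  ∧-true⁻ true e = refl , e

module Reachability where
  open import Defs using (Graph; N; adj; anyV; reach; distFrom; dist)
  open import Data.Nat using (ℕ; zero; suc; _+_; _≤_; _<_; _≤′_; ≤′-refl; ≤′-step; z≤n; s≤s)
  import Data.Nat.Properties as ℕP
  open import Data.Bool using (Bool; true; false; _∧_; _∨_)
  open import Data.Bool.Properties using (T-≡; ∨-zeroʳ)
  open import Data.Bool.ListAction using (any)
  open import Data.List as List using ([]; _∷_; upTo)
  open import Data.List.Membership.Propositional using (find; lose)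
  open import Data.List.Membership.Propositional.Properties using (∈-upTo⁺; ∈-upTo⁻)
  open import Data.List.Relation.Unary.Any.Properties using (any⁺; any⁻)
  open import Data.Product using (_×_; _,_; ∃-syntax)
  open import Data.Sum using (_⊎_; inj₁; inj₂)
  open import Function using (_∘_; Equivalence)
  open import Relation.Binary.PropositionalEquality
  open Booleans

  foldr-∨≡any : ∀ (P : ℕ → Bool) xs → List.foldr (λ v b → P v ∨ b) false xs ≡ any P xs
  foldr-∨≡any P []       = refl
  foldr-∨≡any P (x ∷ xs) = cong (P x ∨_) (foldr-∨≡any P xs)

  anyV⁺ : ∀ n (P : ℕ → Bool) {w} → w < n → P w ≡ true → anyV n P ≡ true
  anyV⁺ n P w<n Pw = trans (foldr-∨≡any P (upTo n))
    (Equivalence.to T-≡ (any⁺ P (lose (∈-upTo⁺ w<n) (Equivalence.from T-≡ Pw))))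

  anyV⁻ : ∀ n (P : ℕ → Bool) → anyV n P ≡ true → ∃[ w ] w < n × P w ≡ true
  anyV⁻ n P e with find (any⁻ P (upTo n) (Equivalence.from T-≡ (trans (sym (foldr-∨≡any P (upTo n))) e)))
  ... | w , w∈ , Pw = w , ∈-upTo⁻ w∈ , Equivalence.to T-≡ Pw

  module _ (G : Graph) where

    Reach : ℕ → ℕ → ℕ → Set
    Reach m x y = reach G m x y ≡ true

    reach-suc⁻ : ∀ m x y → Reach (suc m) x y → Reach m x y ⊎ ∃[ w ] w < N G × Reach m x w × adj G w y ≡ true
    reach-suc⁻ m x y r with ∨-true⁻ (reach G m x y) r
    ... | inj₁ r′ = inj₁ r′
    ... | inj₂ e with anyV⁻ (N G) (λ w → reach G m x w ∧ adj G w y) e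
    ... | w , w<N , e′ with ∧-true⁻ (reach G m x w) e′
    ... | rw , aw = inj₂ (w , w<N , rw , aw)

    reach-suc : ∀ m x y → Reach m x y → Reach (suc m) x y
    reach-suc m x y r rewrite r = refl

    reach-≤ : ∀ {m m′} x y → m ≤ m′ → Reach m x y → Reach m′ x y
    reach-≤ x y = go ∘ ℕP.≤⇒≤′
      where
      go : ∀ {m m′} → m ≤′ m′ → Reach m x y → Reach m′ x y
      go ≤′-refl                 r = r
      go (≤′-step {n} m≤m′) r = reach-suc n x y (go m≤m′ r)

    reach-snoc : ∀ m x w y → Reach m x w → w < N G → adj G w y ≡ true → Reach (suc m) x y
    reach-snoc m x w y r w<N a =
      trans (cong (reach G m x y ∨_) (anyV⁺ (N G) (λ w′ → reach G m x w′ ∧ adj G w′ y) w<N (cong₂ _∧_ r a)))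
            (∨-zeroʳ (reach G m x y))

    reach-refl : ∀ x → Reach 0 x x
    reach-refl = ≡ᵇ-refl

    reach-edge : ∀ x y → x < N G → adj G x y ≡ true → Reach 1 x y
    reach-edge x y = reach-snoc 0 x x y (reach-refl x)

    reach-trans : ∀ a b x y z → Reach a x y → Reach b y z → Reach (a + b) x z
    reach-trans a zero x y z r₁ r₂
      rewrite ℕP.+-identityʳ a | ≡ᵇ-true⇒≡ y z r₂ = r₁
    reach-trans a (suc b) x y z r₁ r₂ rewrite ℕP.+-suc a b with reach-suc⁻ b y z r₂
    ... | inj₁ r                 = reach-suc (a + b) x z (reach-trans a b x y z r₁ r)
    ... | inj₂ (w , w<N , r , e) = reach-snoc (a + b) x w z (reach-trans a b x y w r₁ r) w<N e

    reach-sym : (∀ u v → adj G u v ≡ adj G v u) →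
                ∀ m x y → x < N G → y < N G → Reach m x y → Reach m y x
    reach-sym adj-sym zero x y x<N y<N r rewrite ≡ᵇ-true⇒≡ x y r = reach-refl y
    reach-sym adj-sym (suc m) x y x<N y<N r with reach-suc⁻ m x y r
    ... | inj₁ r′ = reach-suc m y x (reach-sym adj-sym m x y x<N y<N r′)
    ... | inj₂ (w , w<N , r′ , e) =
      reach-trans 1 m y w x (reach-edge y w y<N (trans (adj-sym y w) e)) (reach-sym adj-sym m x w x<N w<N r′)

    reach-bound : (d : ℕ → ℕ → ℕ) → (∀ x → d x x ≡ 0) →
                  (∀ x w y → adj G w y ≡ true → d x y ≤ suc (d x w)) →
                  ∀ m x y → Reach m x y → d x y ≤ m
    reach-bound d d-refl d-edge zero x y r rewrite ≡ᵇ-true⇒≡ x y r | d-refl y = z≤n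
    reach-bound d d-refl d-edge (suc m) x y r with reach-suc⁻ m x y r
    ... | inj₁ r′ = ℕP.m≤n⇒m≤1+n (reach-bound d d-refl d-edge m x y r′)
    ... | inj₂ (w , _ , r′ , e) = ℕP.≤-trans (d-edge x w y e) (s≤s (reach-bound d d-refl d-edge m x w r′))

    dist-unique : ∀ x y d → (∀ m → Reach m x y → d ≤ m) → Reach d x y → d ≤ N G → dist G x y ≡ d
    dist-unique x y d minimal reached d≤N rewrite reach-≤ x y d≤N reached = search (N G) 0 z≤n d≤N
      where
      search : ∀ f m → m ≤ d → d ≤ m + f → distFrom G f m x y ≡ d
      search zero    m m≤d d≤m+0 = ℕP.≤-antisym m≤d (ℕP.≤-trans d≤m+0 (ℕP.≤-reflexive (ℕP.+-identityʳ m)))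
      search (suc f) m m≤d d≤m+f with reach G m x y in eq
      ... | true  = ℕP.≤-antisym m≤d (minimal m eq)
      ... | false with ℕP.m≤n⇒m<n∨m≡n m≤d
      ...   | inj₁ m<d = search f (suc m) m<d (ℕP.≤-trans d≤m+f (ℕP.≤-reflexive (ℕP.+-suc m f)))
      ...   | inj₂ refl with trans (sym eq) reached
      ...     | ()

module Star where
  open import Defs using (starEdges; pathEdges; edgeAdj)
  open import Data.Nat as ℕ using (ℕ; zero; suc; _+_; _∸_; _≤_; _<_; _≡ᵇ_; z≤n; s≤s; ∣_-_∣)
  import Data.Nat.Properties as ℕP
  open import Data.Bool using (true; false; if_then_else_; _∧_; _∨_)
  open import Data.Bool.Properties using (∨-zeroʳ; ∨-assoc; ∨-comm)
  open import Data.List using (List; []; _∷_)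
  open import Data.Nat.ListAction using () renaming (sum to sumL)
  open import Data.List.Membership.Propositional using (_∈_)
  open import Data.List.Relation.Unary.Any using (here; there)
  import Data.List.Membership.Propositional.Properties as ∈P
  open import Data.Product using (_×_; _,_; proj₁; proj₂; ∃-syntax)
  open import Data.Sum using (_⊎_; inj₁; inj₂) renaming (map to ⊎-map)
  open import Data.Empty using (⊥-elim)
  open import Function using (_∘_)
  open import Relation.Nullary using (yes; no)
  open import Relation.Binary.PropositionalEquality
  open Booleans

  -- A vertex of S(ns) is located by the pair (branch, depth): the centre is
  -- (0 , 0) and the j-th vertex of the i-th path is (i , j), both counted from 1.
  nextBranch : ℕ × ℕ → ℕ × ℕ
  nextBranch (b , d) = (suc b , d)

  -- The place of the non-centre vertex suc u (junk values beyond the last path).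
  place : List ℕ → ℕ → ℕ × ℕ
  place []       u = (1 , suc u)
  place (n ∷ ns) u with u ℕ.<? n
  ... | yes _ = (1 , suc u)
  ... | no  _ = nextBranch (place ns (u ∸ n))

  coords : List ℕ → ℕ → ℕ × ℕ
  coords ns zero    = (0 , 0)
  coords ns (suc u) = place ns u

  treeDist : ℕ × ℕ → ℕ × ℕ → ℕ
  treeDist (b , d) (b′ , d′) = if b ≡ᵇ b′ then ∣ d - d′ ∣ else d + d′

  starDist : List ℕ → ℕ → ℕ → ℕ
  starDist ns x y = treeDist (coords ns x) (coords ns y)

  data Split (n u : ℕ) : Set where
    before : u < n → Split n u
    after  : ∀ v → u ≡ n + v → Split n u

  split : ∀ n u → Split n u
  split n u with u ℕ.<? n
  ... | yes u<n = before u<n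
  ... | no  u≮n = after (u ∸ n) (sym (ℕP.m+[n∸m]≡n (ℕP.≮⇒≥ u≮n)))

  place-< : ∀ n ns {u} → u < n → place (n ∷ ns) u ≡ (1 , suc u)
  place-< n ns {u} u<n with u ℕ.<? n
  ... | yes _   = refl
  ... | no  u≮n = ⊥-elim (u≮n u<n)

  place-+ : ∀ n ns v → place (n ∷ ns) (n + v) ≡ nextBranch (place ns v)
  place-+ n ns v with (n + v) ℕ.<? n
  ... | yes n+v<n = ⊥-elim (ℕP.m+n≮m n v n+v<n)
  ... | no  _     = cong (nextBranch ∘ place ns) (ℕP.m+n∸m≡n n v)

  branch-place : ∀ ns u → ∃[ b ] proj₁ (place ns u) ≡ suc b
  branch-place []       u = 0 , refl
  branch-place (n ∷ ns) u with split n u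
  ... | before u<n rewrite place-< n ns u<n = 0 , refl
  ... | after v refl rewrite place-+ n ns v = proj₁ (place ns v) , refl

  depth-place : ∀ ns u → ∃[ e ] proj₂ (place ns u) ≡ suc e
  depth-place []       u = u , refl
  depth-place (n ∷ ns) u with split n u
  ... | before u<n rewrite place-< n ns u<n = u , refl
  ... | after v refl rewrite place-+ n ns v = depth-place ns v

  depth-place-0 : ∀ ns → proj₂ (place ns 0) ≡ 1
  depth-place-0 []            = refl
  depth-place-0 (zero  ∷ ns)  = trans (cong proj₂ (place-+ 0 ns 0)) (depth-place-0 ns)
  depth-place-0 (suc n ∷ ns)  = cong proj₂ (place-< (suc n) ns (s≤s z≤n))

  depth-place-≤ : ∀ ns u → proj₂ (place ns u) ≤ suc u
  depth-place-≤ []       u = ℕP.≤-refl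
  depth-place-≤ (n ∷ ns) u with split n u
  ... | before u<n rewrite place-< n ns u<n = ℕP.≤-refl
  ... | after v refl rewrite place-+ n ns v = ℕP.≤-trans (depth-place-≤ ns v) (s≤s (ℕP.m≤n+m v n))

  place-after : ∀ n ns {u} w → u ≡ n + w → place (n ∷ ns) u ≡ nextBranch (place ns w)
  place-after n ns w refl = place-+ n ns w

  depth-place-start : ∀ n ns {u} → u ≡ n + 0 → proj₂ (place (n ∷ ns) u) ≡ 1
  depth-place-start n ns u≡n+0 = trans (cong proj₂ (place-after n ns 0 u≡n+0)) (depth-place-0 ns)

  -- The first vertex of every path has depth 1, so a vertex of depth ≥ 2 is
  -- preceded in the numbering by its parent.
  place-parent : ∀ ns v {e} → proj₂ (place ns (suc v)) ≡ suc (suc e) →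
                 place ns v ≡ (proj₁ (place ns (suc v)) , suc e)
  place-parent []       v refl = refl
  place-parent (n ∷ ns) v d≡ with split n (suc v)
  ... | before 1+v<n
    rewrite place-< n ns 1+v<n | place-< n ns (ℕP.<-trans (ℕP.n<1+n v) 1+v<n) with d≡
  ...   | refl = refl
  place-parent (n ∷ ns) v d≡ | after zero 1+v≡n+0
    with trans (sym d≡) (depth-place-start n ns 1+v≡n+0)
  ...   | ()
  place-parent (n ∷ ns) v {e} d≡ | after (suc w) 1+v≡n+1+w
    with ℕP.suc-injective (trans 1+v≡n+1+w (ℕP.+-suc n w))
  ...   | refl = begin
    place (n ∷ ns) (n + w)                          ≡⟨ place-+ n ns w ⟩
    nextBranch (place ns w)                         ≡⟨ cong nextBranch (place-parent ns w (trans (sym (cong proj₂ next)) d≡)) ⟩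
    nextBranch (proj₁ (place ns (suc w)) , suc e)   ≡⟨ cong (λ p → proj₁ p , suc e) next ⟨
    (proj₁ (place (n ∷ ns) (suc (n + w))) , suc e)  ∎
    where
    open ≡-Reasoning
    next : place (n ∷ ns) (suc (n + w)) ≡ nextBranch (place ns (suc w))
    next = place-after n ns (suc w) 1+v≡n+1+w

  depth-same-branch : ∀ ns u v → u ≤ v → proj₁ (place ns u) ≡ proj₁ (place ns v) →
                      proj₂ (place ns u) + (v ∸ u) ≡ proj₂ (place ns v)
  depth-same-branch []       u v u≤v _ = cong suc (ℕP.m+[n∸m]≡n u≤v)
  depth-same-branch (n ∷ ns) u v u≤v b≡ with split n u | split n v
  ... | before u<n | before v<n rewrite place-< n ns u<n | place-< n ns v<n = cong suc (ℕP.m+[n∸m]≡n u≤v)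
  ... | before u<n | after w refl rewrite place-< n ns u<n | place-+ n ns w
    with trans b≡ (cong suc (proj₂ (branch-place ns w)))
  ...   | ()
  depth-same-branch (n ∷ ns) u v u≤v b≡ | after w refl | before v<n =
    ⊥-elim (ℕP.m+n≮m n w (ℕP.≤-<-trans u≤v v<n))
  depth-same-branch (n ∷ ns) u v u≤v b≡ | after w₁ refl | after w₂ refl
    rewrite place-+ n ns w₁ | place-+ n ns w₂ | ℕP.[m+n]∸[m+o]≡n∸o n w₂ w₁ =
    depth-same-branch ns w₁ w₂ (ℕP.+-cancelˡ-≤ n w₁ w₂ u≤v) (ℕP.suc-injective b≡)

  depth-other-branch : ∀ ns u v → u ≤ v → proj₁ (place ns u) ≢ proj₁ (place ns v) →
                       proj₂ (place ns u) + proj₂ (place ns v) ≤ suc v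
  depth-other-branch []       u v u≤v b≢ = ⊥-elim (b≢ refl)
  depth-other-branch (n ∷ ns) u v u≤v b≢ with split n u | split n v
  ... | before u<n | before v<n rewrite place-< n ns u<n | place-< n ns v<n = ⊥-elim (b≢ refl)
  ... | before u<n | after w refl rewrite place-< n ns u<n | place-+ n ns w =
    ℕP.≤-trans (ℕP.+-mono-≤ u<n (depth-place-≤ ns w)) (ℕP.≤-reflexive (ℕP.+-suc n w))
  depth-other-branch (n ∷ ns) u v u≤v b≢ | after w refl | before v<n =
    ⊥-elim (ℕP.m+n≮m n w (ℕP.≤-<-trans u≤v v<n))
  depth-other-branch (n ∷ ns) u v u≤v b≢ | after w₁ refl | after w₂ refl
    rewrite place-+ n ns w₁ | place-+ n ns w₂ =
    ℕP.≤-trans (depth-other-branch ns w₁ w₂ (ℕP.+-cancelˡ-≤ n w₁ w₂ u≤v) (b≢ ∘ cong suc))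
               (s≤s (ℕP.m≤n+m w₂ n))

  ∣m-1+n∣≤1+∣m-n∣ : ∀ m n → ∣ m - suc n ∣ ≤ suc ∣ m - n ∣
  ∣m-1+n∣≤1+∣m-n∣ zero    n       = ℕP.≤-refl
  ∣m-1+n∣≤1+∣m-n∣ (suc m) zero    = ℕP.≤-trans (ℕP.≤-reflexive (ℕP.∣-∣-identityʳ m)) (ℕP.m≤n+m m 2)
  ∣m-1+n∣≤1+∣m-n∣ (suc m) (suc n) = ∣m-1+n∣≤1+∣m-n∣ m n

  ∣m-n∣≤1+∣m-1+n∣ : ∀ m n → ∣ m - n ∣ ≤ suc ∣ m - suc n ∣
  ∣m-n∣≤1+∣m-1+n∣ zero    n       = ℕP.m≤n+m n 2
  ∣m-n∣≤1+∣m-1+n∣ (suc m) zero    = ℕP.≤-reflexive (cong suc (sym (ℕP.∣-∣-identityʳ m)))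
  ∣m-n∣≤1+∣m-1+n∣ (suc m) (suc n) = ∣m-n∣≤1+∣m-1+n∣ m n

  treeDist-refl : ∀ p → treeDist p p ≡ 0
  treeDist-refl (b , d) rewrite ≡ᵇ-refl b = ℕP.∣n-n∣≡0 d

  treeDist-centreˡ : ∀ q → treeDist (0 , 0) q ≡ proj₂ q
  treeDist-centreˡ (b , d) with 0 ≡ᵇ b
  ... | true  = refl
  ... | false = refl

  -- The centre is the depth-0 point of every branch.
  treeDist-centreʳ : ∀ p b → treeDist p (b , 0) ≡ proj₂ p
  treeDist-centreʳ (b′ , d) b with b′ ≡ᵇ b
  ... | true  = ℕP.∣-∣-identityʳ d
  ... | false = ℕP.+-identityʳ d

  Close : ℕ × ℕ → ℕ × ℕ → Set
  Close p q = ∀ r → treeDist r q ≤ suc (treeDist r p) × treeDist r p ≤ suc (treeDist r q)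

  close-sym : ∀ {p q} → Close p q → Close q p
  close-sym close r = proj₂ (close r) , proj₁ (close r)

  close-step : ∀ b d → Close (b , d) (b , suc d)
  close-step b d (b′ , d′) with b′ ≡ᵇ b
  ... | true  = ∣m-1+n∣≤1+∣m-n∣ d′ d , ∣m-n∣≤1+∣m-1+n∣ d′ d
  ... | false = ℕP.≤-reflexive (ℕP.+-suc d′ d) , ℕP.m≤n⇒m≤1+n (ℕP.+-monoʳ-≤ d′ (ℕP.n≤1+n d))

  close-centre : ∀ b → Close (0 , 0) (b , 1)
  close-centre b r = subst (λ t → treeDist r (b , 1) ≤ suc t × t ≤ suc (treeDist r (b , 1)))
                           (trans (treeDist-centreʳ r b) (sym (treeDist-centreʳ r 0)))
                           (close-step b 0 r)

  edgeAdj-∈ : ∀ es {u v} → (u , v) ∈ es → edgeAdj es u v ≡ true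
  edgeAdj-∈ ((u , v) ∷ es) (here refl) rewrite ≡ᵇ-refl u | ≡ᵇ-refl v = refl
  edgeAdj-∈ ((a , b) ∷ es) {u} {v} (there uv∈es) rewrite edgeAdj-∈ es uv∈es =
    trans (cong (((a ≡ᵇ u) ∧ (b ≡ᵇ v)) ∨_) (∨-zeroʳ ((a ≡ᵇ v) ∧ (b ≡ᵇ u)))) (∨-zeroʳ _)

  edgeAdj-sym : ∀ es u v → edgeAdj es u v ≡ edgeAdj es v u
  edgeAdj-sym []             u v = refl
  edgeAdj-sym ((a , b) ∷ es) u v rewrite edgeAdj-sym es u v =
    ∨-swapˡ ((a ≡ᵇ u) ∧ (b ≡ᵇ v)) ((a ≡ᵇ v) ∧ (b ≡ᵇ u)) (edgeAdj es v u)
    where ∨-swapˡ : ∀ x y z → x ∨ y ∨ z ≡ y ∨ x ∨ z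
          ∨-swapˡ x y z = trans (sym (∨-assoc x y z)) (trans (cong (_∨ z) (∨-comm x y)) (∨-assoc y x z))

  edgeAdj⁻ : ∀ es u v → edgeAdj es u v ≡ true → (u , v) ∈ es ⊎ (v , u) ∈ es
  edgeAdj⁻ []             u v ()
  edgeAdj⁻ ((a , b) ∷ es) u v adj with ∨-true⁻ ((a ≡ᵇ u) ∧ (b ≡ᵇ v)) adj
  ... | inj₁ ab≡uv with ∧-true⁻ (a ≡ᵇ u) ab≡uv
  ...   | a≡u , b≡v rewrite ≡ᵇ-true⇒≡ a u a≡u | ≡ᵇ-true⇒≡ b v b≡v = inj₁ (here refl)
  edgeAdj⁻ ((a , b) ∷ es) u v adj | inj₂ rest with ∨-true⁻ ((a ≡ᵇ v) ∧ (b ≡ᵇ u)) rest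
  ... | inj₁ ab≡vu with ∧-true⁻ (a ≡ᵇ v) ab≡vu
  ...   | a≡v , b≡u rewrite ≡ᵇ-true⇒≡ a v a≡v | ≡ᵇ-true⇒≡ b u b≡u = inj₂ (here refl)
  edgeAdj⁻ ((a , b) ∷ es) u v adj | inj₂ rest | inj₂ adj′ =
    ⊎-map there there (edgeAdj⁻ es u v adj′)

  m<n∸1⇒1+m<n : ∀ {m} n → m < n ∸ 1 → suc m < n
  m<n∸1⇒1+m<n (suc n) m<n = s≤s m<n

  1+m<n⇒m<n∸1 : ∀ {m} n → suc m < n → m < n ∸ 1
  1+m<n⇒m<n∸1 (suc n) (s≤s m<n) = m<n

  module _ (L : List ℕ) where

    -- The paths ns occupy the non-centre vertices of S(L) from suc s on, in the
    -- branches after the first c.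
    SuffixAt : ℕ → ℕ → List ℕ → Set
    SuffixAt s c ns = ∀ u → place L (s + u) ≡ (c + proj₁ (place ns u) , proj₂ (place ns u))

    suffixAt-tail : ∀ {s c n ns} → SuffixAt s c (n ∷ ns) → SuffixAt (s + n) (suc c) ns
    suffixAt-tail {s} {c} {n} {ns} at u = begin
      place L (s + n + u)                                  ≡⟨ cong (place L) (ℕP.+-assoc s n u) ⟩
      place L (s + (n + u))                                ≡⟨ at (n + u) ⟩
      (c + proj₁ (place (n ∷ ns) (n + u)) , proj₂ (place (n ∷ ns) (n + u)))
        ≡⟨ cong (λ p → c + proj₁ p , proj₂ p) (place-+ n ns u) ⟩
      (c + suc (proj₁ (place ns u)) , proj₂ (place ns u))  ≡⟨ cong (_, proj₂ (place ns u)) (ℕP.+-suc c _) ⟩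
      (suc c + proj₁ (place ns u) , proj₂ (place ns u))    ∎
      where open ≡-Reasoning

    coords-path : ∀ {s c n ns} → SuffixAt s c (n ∷ ns) → ∀ {j} → j < n → coords L (s + suc j) ≡ (c + 1 , suc j)
    coords-path {s} {c} {n} {ns} at {j} j<n =
      trans (cong (coords L) (ℕP.+-suc s j))
            (trans (at j) (cong (λ p → c + proj₁ p , proj₂ p) (place-< n ns j<n)))

    coords-root : ∀ {s c n ns} → SuffixAt s c (n ∷ ns) → ∃[ b ] coords L (s + 1) ≡ (b , 1)
    coords-root {s} {c} {n} {ns} at =
      c + proj₁ (place (n ∷ ns) 0) ,
      trans (cong (coords L) (ℕP.+-suc s 0))
            (trans (at 0) (cong (c + proj₁ (place (n ∷ ns) 0) ,_) (depth-place-0 (n ∷ ns))))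

    starEdges-close : ∀ s c ns → SuffixAt s c ns →
                      ∀ {x y} → (x , y) ∈ starEdges s ns → Close (coords L x) (coords L y)
    starEdges-close s c (n ∷ ns) at (here refl) with coords-root {s} {c} {n} {ns} at
    ... | b , eq rewrite eq = close-centre b
    starEdges-close s c (n ∷ ns) at (there e∈) with ∈P.∈-++⁻ (pathEdges s n) e∈
    ... | inj₂ e∈rest = starEdges-close (s + n) (suc c) ns (suffixAt-tail {s} {c} {n} {ns} at) e∈rest
    ... | inj₁ e∈path with ∈P.∈-map⁻ (λ j → (s + suc j , s + suc (suc j))) e∈path
    ...   | j , j∈ , refl
      rewrite coords-path {s} {c} {n} {ns} at (ℕP.<-trans (ℕP.n<1+n j) (m<n∸1⇒1+m<n n (∈P.∈-upTo⁻ j∈)))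
            | coords-path {s} {c} {n} {ns} at (m<n∸1⇒1+m<n n (∈P.∈-upTo⁻ j∈)) = close-step (c + 1) (suc j)

    adj-close : ∀ x y → edgeAdj (starEdges 0 L) x y ≡ true → Close (coords L x) (coords L y)
    adj-close x y adj with edgeAdj⁻ (starEdges 0 L) x y adj
    ... | inj₁ xy∈ = starEdges-close 0 0 L (λ u → refl) xy∈
    ... | inj₂ yx∈ = close-sym (starEdges-close 0 0 L (λ u → refl) yx∈)

  pathEdge-∈ : ∀ s ns v {e} → proj₂ (place ns (suc v)) ≡ suc (suc e) → suc v < sumL ns →
               (s + suc v , s + suc (suc v)) ∈ starEdges s ns
  pathEdge-∈ s (n ∷ ns) v d≡ 1+v<Σ with split n (suc v)
  ... | before 1+v<n =
    there (∈P.∈-++⁺ˡ (∈P.∈-map⁺ (λ j → (s + suc j , s + suc (suc j))) (∈P.∈-upTo⁺ (1+m<n⇒m<n∸1 n 1+v<n))))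
  ... | after zero 1+v≡n+0
    with trans (sym d≡) (depth-place-start n ns 1+v≡n+0)
  ...   | ()
  pathEdge-∈ s (n ∷ ns) v {e} d≡ 1+v<Σ | after (suc w) 1+v≡n+1+w =
    there (∈P.∈-++⁺ʳ (pathEdges s n) (subst₂ (λ a b → (a , b) ∈ starEdges (s + n) ns) e₁ e₂
      (pathEdge-∈ (s + n) ns w d≡′ (ℕP.+-cancelˡ-< n (suc w) (sumL ns) (subst (_< n + sumL ns) 1+v≡n+1+w 1+v<Σ)))))
    where
    e₁ : (s + n) + suc w ≡ s + suc v
    e₁ = trans (ℕP.+-assoc s n (suc w)) (cong (s +_) (sym 1+v≡n+1+w))
    e₂ : (s + n) + suc (suc w) ≡ s + suc (suc v)
    e₂ = trans (ℕP.+-assoc s n (suc (suc w))) (cong (s +_) (trans (ℕP.+-suc n (suc w)) (cong suc (sym 1+v≡n+1+w))))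
    d≡′ : proj₂ (place ns (suc w)) ≡ suc (suc e)
    d≡′ = trans (sym (cong proj₂ (place-after n ns (suc w) 1+v≡n+1+w))) d≡

  rootEdge-∈ : ∀ s ns u → proj₂ (place ns u) ≡ 1 → u < sumL ns → (0 , s + suc u) ∈ starEdges s ns
  rootEdge-∈ s (n ∷ ns) u d≡1 u<Σ with split n u
  ... | before u<n rewrite place-< n ns u<n with d≡1
  ...   | refl = here refl
  rootEdge-∈ s (n ∷ ns) u d≡1 u<Σ | after w refl =
    there (∈P.∈-++⁺ʳ (pathEdges s n) (subst (λ a → (0 , a) ∈ starEdges (s + n) ns) shift
      (rootEdge-∈ (s + n) ns w (trans (sym (cong proj₂ (place-+ n ns w))) d≡1) (ℕP.+-cancelˡ-< n w (sumL ns) u<Σ))))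
    where
    shift : (s + n) + suc w ≡ s + suc (n + w)
    shift = trans (ℕP.+-assoc s n (suc w)) (cong (s +_) (ℕP.+-suc n w))

module StarDistance where
  open import Defs using (Graph; N; adj; dist; starEdges; edgeAdj)
  open import Data.Nat using (ℕ; zero; suc; _+_; _∸_; _≤_; _<_; _≡ᵇ_; z≤n; s≤s; ∣_-_∣)
  import Data.Nat.Properties as ℕP
  open import Data.Bool using (true; false)
  open import Data.List using (List)
  open import Data.Nat.ListAction using () renaming (sum to sumL)
  open import Data.Product using (_×_; _,_; proj₁; proj₂)
  open import Data.Sum using (inj₁; inj₂)
  open import Relation.Binary.PropositionalEquality
  open Booleans
  open Reachability
  open Star

  starGraph : List ℕ → Graph
  starGraph L = record { N = suc (sumL L) ; adj = edgeAdj (starEdges 0 L) }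

  module _ (L : List ℕ) where
    private
      G : Graph
      G = starGraph L

    adj-path : ∀ v {e} → proj₂ (place L (suc v)) ≡ suc (suc e) → suc v < sumL L →
               adj G (suc v) (suc (suc v)) ≡ true
    adj-path v d≡ 1+v<Σ = edgeAdj-∈ (starEdges 0 L) (pathEdge-∈ 0 L v d≡ 1+v<Σ)

    adj-root : ∀ u → proj₂ (place L u) ≡ 1 → u < sumL L → adj G 0 (suc u) ≡ true
    adj-root u d≡1 u<Σ = edgeAdj-∈ (starEdges 0 L) (rootEdge-∈ 0 L u d≡1 u<Σ)

    reach-from-centre : ∀ u → u < sumL L → Reach G (proj₂ (place L u)) 0 (suc u)
    reach-from-centre u u<Σ with proj₂ (place L u) in d≡
    ... | zero with trans (sym d≡) (proj₂ (depth-place L u))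
    ...   | ()
    reach-from-centre u u<Σ | suc zero = reach-edge G 0 (suc u) (s≤s z≤n) (adj-root u d≡ u<Σ)
    reach-from-centre zero u<Σ | suc (suc e) with trans (sym d≡) (depth-place-0 L)
    ... | ()
    reach-from-centre (suc u) u<Σ | suc (suc e) =
      reach-snoc G (suc e) 0 (suc u) (suc (suc u))
        (subst (λ t → Reach G t 0 (suc u)) (cong proj₂ (place-parent L u d≡)) (reach-from-centre u u<Σ′))
        (s≤s u<Σ′) (adj-path u d≡ u<Σ)
      where
      u<Σ′ : u < sumL L
      u<Σ′ = ℕP.<-trans (ℕP.n<1+n u) u<Σ

    reach-along-branch : ∀ u v → u ≤ v → proj₁ (place L u) ≡ proj₁ (place L v) → v < sumL L →
                         Reach G (v ∸ u) (suc u) (suc v)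
    reach-along-branch u zero    z≤n  _  _ = reach-refl G 1
    reach-along-branch u (suc v) u≤1+v b≡ 1+v<Σ with ℕP.m≤n⇒m<n∨m≡n u≤1+v
    ... | inj₂ refl rewrite ℕP.n∸n≡0 u = reach-refl G (suc u)
    ... | inj₁ (s≤s u≤v) =
      subst (λ t → Reach G t (suc u) (suc (suc v))) (sym (ℕP.+-∸-assoc 1 u≤v))
        (reach-snoc G (v ∸ u) (suc u) (suc v) (suc (suc v))
          (reach-along-branch u v u≤v (trans b≡ (sym (cong proj₁ (place-parent L v d≡)))) v<Σ)
          (s≤s v<Σ) (adj-path v d≡ 1+v<Σ))
      where
      v<Σ : v < sumL L
      v<Σ = ℕP.<-trans (ℕP.n<1+n v) 1+v<Σ
      a : ℕ
      a = proj₁ (depth-place L u)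
      d≡ : proj₂ (place L (suc v)) ≡ suc (suc (a + (v ∸ u)))
      d≡ = begin
        proj₂ (place L (suc v))             ≡⟨ depth-same-branch L u (suc v) u≤1+v b≡ ⟨
        proj₂ (place L u) + (suc v ∸ u)     ≡⟨ cong₂ _+_ (proj₂ (depth-place L u)) (ℕP.+-∸-assoc 1 u≤v) ⟩
        suc a + suc (v ∸ u)                 ≡⟨ cong suc (ℕP.+-suc a (v ∸ u)) ⟩
        suc (suc (a + (v ∸ u)))             ∎
        where open ≡-Reasoning

    starDist-≤-walk : ∀ m x y → Reach G m x y → starDist L x y ≤ m
    starDist-≤-walk = reach-bound G (starDist L) (λ x → treeDist-refl (coords L x))
                        (λ x w y e → proj₁ (adj-close L w y e (coords L x)))

    starDist-walk : ∀ x y → x < y → y < N G → Reach G (starDist L x y) x y × starDist L x y ≤ N G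
    starDist-walk zero (suc v) _ (s≤s v<Σ) rewrite treeDist-centreˡ (place L v) =
      reach-from-centre v v<Σ , ℕP.≤-trans (depth-place-≤ L v) (s≤s (ℕP.<⇒≤ v<Σ))
    starDist-walk (suc u) (suc v) (s≤s u<v) (s≤s v<Σ)
      with proj₁ (place L u) ≡ᵇ proj₁ (place L v) in b≡ᵇ
    ... | true = subst (λ t → Reach G t (suc u) (suc v)) (sym dist≡)
                   (reach-along-branch u v (ℕP.<⇒≤ u<v) b≡ v<Σ) ,
                 ℕP.≤-trans (ℕP.≤-reflexive dist≡) (ℕP.≤-trans (ℕP.m∸n≤m v u) (ℕP.m≤n⇒m≤1+n (ℕP.<⇒≤ v<Σ)))
      where
      b≡ : proj₁ (place L u) ≡ proj₁ (place L v)
      b≡ = ≡ᵇ-true⇒≡ _ _ b≡ᵇ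
      dist≡ : ∣ proj₂ (place L u) - proj₂ (place L v) ∣ ≡ v ∸ u
      dist≡ = trans (cong (∣ proj₂ (place L u) -_∣) (sym (depth-same-branch L u v (ℕP.<⇒≤ u<v) b≡)))
                    (ℕP.∣m-m+n∣≡n (proj₂ (place L u)) (v ∸ u))
    ... | false =
      reach-trans G (proj₂ (place L u)) (proj₂ (place L v)) (suc u) 0 (suc v)
        (reach-sym G (edgeAdj-sym (starEdges 0 L)) (proj₂ (place L u)) 0 (suc u) (s≤s z≤n) (s≤s u<Σ) (reach-from-centre u u<Σ))
        (reach-from-centre v v<Σ) ,
      ℕP.≤-trans (depth-other-branch L u v (ℕP.<⇒≤ u<v) b≢) (s≤s (ℕP.<⇒≤ v<Σ))
      where
      u<Σ : u < sumL L
      u<Σ = ℕP.<-trans u<v v<Σ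
      b≢ : proj₁ (place L u) ≢ proj₁ (place L v)
      b≢ b≡ with trans (sym (≡ᵇ-refl (proj₁ (place L v)))) (subst (λ b → (b ≡ᵇ proj₁ (place L v)) ≡ false) b≡ b≡ᵇ)
      ... | ()

    dist-starGraph : ∀ x y → x < y → y < N G → dist G x y ≡ starDist L x y
    dist-starGraph x y x<y y<N = dist-unique G x y (starDist L x y) (λ m → starDist-≤-walk m x y)
                                   (proj₁ (starDist-walk x y x<y y<N)) (proj₂ (starDist-walk x y x<y y<N))

module StarHarary where
  open import Defs using (inv)
  open import Data.Nat as ℕ using (ℕ; zero; suc; _∸_; _<_; s≤s)
  import Data.Nat.Properties as ℕP
  open import Data.List using (List; []; _∷_)
  open import Data.Nat.ListAction using () renaming (sum to sumL)
  open import Data.Rational using (ℚ; _+_; 0ℚ)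
  import Data.Rational.Properties as ℚP
  open import Data.Product using (_,_; proj₂)
  open import Function using (_∘_)
  open import Relation.Binary.PropositionalEquality
  open Sums
  open Star

  harmonic : ℕ → ℚ
  harmonic n = ∑ n (λ x → inv (suc x))

  -- H(P_{n+1}): a branch of length n together with the centre.
  pathHarary : ℕ → ℚ
  pathHarary n = ∑ (suc n) harmonic

  -- Reciprocal distances from a vertex at depth e of one branch to a
  -- branch of length n, and between two branches of lengths n and m.
  crossRow : ℕ → ℕ → ℚ
  crossRow n e = ∑ n (λ c → inv (suc c ℕ.+ e))

  crossHarary : ℕ → ℕ → ℚ
  crossHarary n m = ∑ m (λ d → crossRow n (suc d))

  ∑ₗ : (ℕ → ℚ) → List ℕ → ℚ
  ∑ₗ W []       = 0ℚ
  ∑ₗ W (m ∷ ms) = W m + ∑ₗ W ms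

  starHarary : List ℕ → ℚ
  starHarary []       = 0ℚ
  starHarary (n ∷ ns) = pathHarary n + starHarary ns + ∑ₗ (crossHarary n) ns

  treeHarary : List ℕ → ℚ
  treeHarary L = ∑ (suc (sumL L)) (λ y → ∑ y (λ x → inv (starDist L x y)))

  ∑-inv-gaps : ∀ y → ∑ y (λ x → inv (y ∸ x)) ≡ harmonic y
  ∑-inv-gaps zero    = refl
  ∑-inv-gaps (suc y) = begin
    ∑ (suc y) (λ x → inv (suc y ∸ x))          ≡⟨ ∑-unfoldˡ y (λ x → inv (suc y ∸ x)) ⟩
    inv (suc y) + ∑ y (λ x → inv (y ∸ x))      ≡⟨ cong (inv (suc y) +_) (∑-inv-gaps y) ⟩
    inv (suc y) + harmonic y                   ≡⟨ ℚP.+-comm (inv (suc y)) (harmonic y) ⟩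
    harmonic (suc y)                           ∎
    where open ≡-Reasoning

  starDist-first : ∀ n ns x y → x < y → y < suc n → starDist (n ∷ ns) x y ≡ y ∸ x
  starDist-first n ns zero    (suc y) _         (s≤s y<n) =
    trans (treeDist-centreˡ (place (n ∷ ns) y)) (cong proj₂ (place-< n ns y<n))
  starDist-first n ns (suc x) (suc y) (s≤s x<y) (s≤s y<n)
    rewrite place-< n ns y<n | place-< n ns (ℕP.<-trans x<y y<n) = ℕP.m≤n⇒∣m-n∣≡n∸m (ℕP.<⇒≤ x<y)

  ∑-first-path : ∀ n ns → ∑ (suc n) (λ y → ∑ y (λ x → inv (starDist (n ∷ ns) x y))) ≡ pathHarary n
  ∑-first-path n ns = ∑-cong (suc n) (λ y y<1+n →
    trans (∑-cong y (λ x x<y → cong inv (starDist-first n ns x y x<y y<1+n))) (∑-inv-gaps y))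

  row-beyond-first : ∀ n ns v →
    ∑ (suc n ℕ.+ v) (λ x → inv (starDist (n ∷ ns) x (suc n ℕ.+ v)))
      ≡ ∑ (suc v) (λ x → inv (starDist ns x (suc v))) + crossRow n (proj₂ (place ns v))
  row-beyond-first n ns v = begin
    ∑ (suc n ℕ.+ v) g                                      ≡⟨ ∑-+ (suc n) v g ⟩
    ∑ (suc n) g + ∑ v (λ u → g (suc n ℕ.+ u))              ≡⟨ cong (_+ ∑ v (λ u → g (suc n ℕ.+ u))) (∑-unfoldˡ n g) ⟩
    (g 0 + ∑ n (λ c → g (suc c))) + ∑ v (λ u → g (suc n ℕ.+ u))
      ≡⟨ cong₂ _+_ (cong₂ _+_ centre (∑-cong n (λ c c<n → cong inv (first c c<n))))
                   (∑-cong v (λ u _ → cong inv (later u))) ⟩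
    (gr 0 + crossRow n d) + ∑ v (λ u → gr (suc u))          ≡⟨ ℚ+.xy∙z≈xz∙y (gr 0) (crossRow n d) _ ⟩
    (gr 0 + ∑ v (λ u → gr (suc u))) + crossRow n d          ≡⟨ cong (_+ crossRow n d) (∑-unfoldˡ v gr) ⟨
    ∑ (suc v) gr + crossRow n d                            ∎
    where
    open ≡-Reasoning
    g gr : ℕ → ℚ
    g x = inv (starDist (n ∷ ns) x (suc n ℕ.+ v))
    gr x = inv (starDist ns x (suc v))
    d : ℕ
    d = proj₂ (place ns v)
    centre : g 0 ≡ gr 0
    centre = cong inv (trans (treeDist-centreˡ (place (n ∷ ns) (n ℕ.+ v)))
                       (trans (cong proj₂ (place-+ n ns v)) (sym (treeDist-centreˡ (place ns v)))))
    first : ∀ c → c < n → starDist (n ∷ ns) (suc c) (suc n ℕ.+ v) ≡ suc c ℕ.+ d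
    first c c<n rewrite place-< n ns c<n | place-+ n ns v | proj₂ (branch-place ns v) = refl
    later : ∀ u → starDist (n ∷ ns) (suc n ℕ.+ u) (suc n ℕ.+ v) ≡ starDist ns (suc u) (suc v)
    later u = cong₂ treeDist (place-+ n ns u) (place-+ n ns v)

  ∑-over-depths : ∀ (φ : ℕ → ℚ) ns → ∑ (sumL ns) (λ v → φ (proj₂ (place ns v))) ≡ ∑ₗ (λ m → ∑ m (λ d → φ (suc d))) ns
  ∑-over-depths φ []       = refl
  ∑-over-depths φ (m ∷ ns) = trans (∑-+ m (sumL ns) _)
    (cong₂ _+_ (∑-cong m (λ v v<m → cong (φ ∘ proj₂) (place-< m ns v<m)))
               (trans (∑-cong (sumL ns) (λ w _ → cong (φ ∘ proj₂) (place-+ m ns w))) (∑-over-depths φ ns)))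

  treeHarary-∷ : ∀ n ns → treeHarary (n ∷ ns) ≡
                 pathHarary n + treeHarary ns + ∑ (sumL ns) (λ v → crossRow n (proj₂ (place ns v)))
  treeHarary-∷ n ns = begin
    treeHarary (n ∷ ns)                                      ≡⟨ ∑-+ (suc n) (sumL ns) F ⟩
    ∑ (suc n) F + ∑ (sumL ns) (λ v → F (suc n ℕ.+ v))
      ≡⟨ cong₂ _+_ (∑-first-path n ns) (∑-cong (sumL ns) (λ v _ → row-beyond-first n ns v)) ⟩
    pathHarary n + ∑ (sumL ns) (λ v → Fr (suc v) + X v)     ≡⟨ cong (pathHarary n +_) (∑-distrib-+ (sumL ns) (Fr ∘ suc) X) ⟩
    pathHarary n + (∑ (sumL ns) (Fr ∘ suc) + ∑ (sumL ns) X)  ≡⟨ cong (λ t → pathHarary n + (t + ∑ (sumL ns) X)) rest ⟩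
    pathHarary n + (treeHarary ns + ∑ (sumL ns) X)           ≡⟨ ℚP.+-assoc (pathHarary n) (treeHarary ns) _ ⟨
    pathHarary n + treeHarary ns + ∑ (sumL ns) X             ∎
    where
    open ≡-Reasoning
    F Fr X : ℕ → ℚ
    F y = ∑ y (λ x → inv (starDist (n ∷ ns) x y))
    Fr y = ∑ y (λ x → inv (starDist ns x y))
    X v = crossRow n (proj₂ (place ns v))
    rest : ∑ (sumL ns) (Fr ∘ suc) ≡ treeHarary ns
    rest = sym (trans (∑-unfoldˡ (sumL ns) Fr) (ℚP.+-identityˡ _))

  treeHarary≡starHarary : ∀ L → treeHarary L ≡ starHarary L
  treeHarary≡starHarary []       = ℚP.+-identityˡ 0ℚ
  treeHarary≡starHarary (n ∷ ns) = trans (treeHarary-∷ n ns)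
    (cong₂ (λ a b → pathHarary n + a + b) (treeHarary≡starHarary ns) (∑-over-depths (crossRow n) ns))

module Transfer where
  open import Defs using (inv)
  open import Data.Nat as ℕ using (ℕ; zero; suc; s≤s)
  import Data.Nat.Properties as ℕP
  open import Data.List using (List; []; _∷_; _++_)
  open import Data.Rational using (ℚ; _+_; _≤_; 0ℚ; toℚᵘ)
  import Data.Rational.Properties as ℚP
  import Data.Rational.Unnormalised as ℚᵘ
  import Data.Rational.Unnormalised.Properties as ℚᵘP
  import Data.Integer as ℤ
  import Data.Integer.Properties as ℤP
  open import Data.Rational.Solver using (module +-*-Solver)
  open import Function using (_∘_)
  open import Relation.Binary.PropositionalEquality
  open +-*-Solver
  open Sums
  open StarHarary

  inv-antitone : ∀ {a b} → a ℕ.≤ b → inv (suc b) ≤ inv (suc a)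
  inv-antitone {a} {b} a≤b = ℚP.toℚᵘ-cancel-≤ (begin
      toℚᵘ (inv (suc b))  ≃⟨ ℚP.toℚᵘ-fromℚᵘ (ℚᵘ.mkℚᵘ (ℤ.+ 1) b) ⟩
      ℚᵘ.mkℚᵘ (ℤ.+ 1) b      ≤⟨ ℚᵘ.*≤* (ℤP.*-monoˡ-≤-nonNeg (ℤ.+ 1) (ℤ.+≤+ (ℕ.s≤s a≤b))) ⟩
      ℚᵘ.mkℚᵘ (ℤ.+ 1) a      ≃⟨ ℚᵘP.≃-sym (ℚP.toℚᵘ-fromℚᵘ (ℚᵘ.mkℚᵘ (ℤ.+ 1) a)) ⟩
      toℚᵘ (inv (suc a))  ∎)
    where open ℚᵘP.≤-Reasoning

  -- Two branches of lengths a and b form, with the centre, a path on a+b+1 vertices.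
  pathHarary-+ : ∀ a b → pathHarary (a ℕ.+ b) ≡ pathHarary a + pathHarary b + crossHarary a b
  pathHarary-+ a zero =
    trans (cong pathHarary (ℕP.+-identityʳ a))
          (sym (trans (ℚP.+-identityʳ _) (ℚP.+-identityʳ (pathHarary a))))
  pathHarary-+ a (suc b) = begin
    pathHarary (a ℕ.+ suc b)                   ≡⟨ cong pathHarary (ℕP.+-suc a b) ⟩
    pathHarary (a ℕ.+ b) + harmonic (suc (a ℕ.+ b))
      ≡⟨ cong₂ _+_ (pathHarary-+ a b) harmonic-split ⟩
    (pathHarary a + pathHarary b + crossHarary a b) + (harmonic (suc b) + crossRow a (suc b))
      ≡⟨ solve 5 (λ p q g h r → (p :+ q :+ g) :+ (h :+ r) := p :+ (q :+ h) :+ (g :+ r)) refl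
                 (pathHarary a) (pathHarary b) (crossHarary a b) (harmonic (suc b)) (crossRow a (suc b)) ⟩
    pathHarary a + pathHarary (suc b) + crossHarary a (suc b)  ∎
    where
    open ≡-Reasoning
    harmonic-split : harmonic (suc (a ℕ.+ b)) ≡ harmonic (suc b) + crossRow a (suc b)
    harmonic-split = trans (cong (harmonic ∘ suc) (ℕP.+-comm a b))
      (trans (∑-+ (suc b) a (λ x → inv (suc x)))
             (cong (harmonic (suc b) +_) (∑-cong a (λ c _ → cong inv (cong suc
               (trans (cong suc (ℕP.+-comm b c)) (sym (ℕP.+-suc c b))))))))

  pathHarary-exchange : ∀ a b → pathHarary (suc a) + pathHarary b + crossHarary (suc a) b
                              ≡ pathHarary a + pathHarary (suc b) + crossHarary a (suc b)
  pathHarary-exchange a b = trans (sym (pathHarary-+ (suc a) b))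
                                  (trans (cong pathHarary (sym (ℕP.+-suc a b))) (pathHarary-+ a (suc b)))

  crossHarary-comm : ∀ a b → crossHarary a b ≡ crossHarary b a
  crossHarary-comm a b = trans (∑-comm b a (λ d c → inv (suc c ℕ.+ suc d)))
    (∑-cong a (λ c _ → ∑-cong b (λ d _ → cong inv (ℕP.+-comm (suc c) (suc d)))))

  crossRow-antitone : ∀ n {i j} → i ℕ.≤ j → crossRow n j ≤ crossRow n i
  crossRow-antitone n i≤j = ∑-mono-≤ n (λ c → inv-antitone (ℕP.+-monoʳ-≤ c i≤j))

  Concave : (ℕ → ℚ) → Set
  Concave W = ∀ i j → i ℕ.≤ j → W (suc j) + W i ≤ W (suc i) + W j

  concave-+ : ∀ {V W} → Concave V → Concave W → Concave (λ m → V m + W m)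
  concave-+ {V} {W} V-concave W-concave i j i≤j =
    subst₂ _≤_ (ℚ+.interchange (V (suc j)) (V i) (W (suc j)) (W i))
               (ℚ+.interchange (V (suc i)) (V j) (W (suc i)) (W j))
      (ℚP.+-mono-≤ (V-concave i j i≤j) (W-concave i j i≤j))

  concave-zero : Concave (λ _ → 0ℚ)
  concave-zero _ _ _ = ℚP.≤-refl

  crossHarary-concave : ∀ n → Concave (crossHarary n)
  crossHarary-concave n i j i≤j =
    subst₂ _≤_ (ℚ+.x∙yz≈yz∙x (crossHarary n i) (crossHarary n j) (crossRow n (suc j)))
               (ℚ+.x∙yz≈xz∙y (crossHarary n i) (crossHarary n j) (crossRow n (suc i)))
      (ℚP.+-monoʳ-≤ (crossHarary n i) (ℚP.+-monoʳ-≤ (crossHarary n j) (crossRow-antitone n (s≤s i≤j))))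

  -- H(S(ns)) plus a weight W m for every path of length m: removing the first
  -- path of a star turns its cross terms into such weights on the others.
  weightedHarary : (ℕ → ℚ) → List ℕ → ℚ
  weightedHarary W ns = starHarary ns + ∑ₗ W ns

  ∑ₗ-distrib-+ : ∀ (V W : ℕ → ℚ) ns → ∑ₗ (λ m → V m + W m) ns ≡ ∑ₗ V ns + ∑ₗ W ns
  ∑ₗ-distrib-+ V W []       = sym (ℚP.+-identityˡ 0ℚ)
  ∑ₗ-distrib-+ V W (m ∷ ns) =
    trans (cong (V m + W m +_) (∑ₗ-distrib-+ V W ns)) (ℚ+.interchange (V m) (W m) (∑ₗ V ns) (∑ₗ W ns))

  ∑ₗ-mono-≤ : ∀ {V W : ℕ → ℚ} ns → (∀ m → V m ≤ W m) → ∑ₗ V ns ≤ ∑ₗ W ns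
  ∑ₗ-mono-≤ []       V≤W = ℚP.≤-refl
  ∑ₗ-mono-≤ (m ∷ ns) V≤W = ℚP.+-mono-≤ (V≤W m) (∑ₗ-mono-≤ ns V≤W)

  ∑ₗ-cong : ∀ {V W : ℕ → ℚ} ns → (∀ m → V m ≡ W m) → ∑ₗ V ns ≡ ∑ₗ W ns
  ∑ₗ-cong []       V≡W = refl
  ∑ₗ-cong (m ∷ ns) V≡W = cong₂ _+_ (V≡W m) (∑ₗ-cong ns V≡W)

  weightedHarary-zero : ∀ ns → weightedHarary (λ _ → 0ℚ) ns ≡ starHarary ns
  weightedHarary-zero ns = trans (cong (starHarary ns +_) (∑ₗ-zero ns)) (ℚP.+-identityʳ (starHarary ns))
    where
    ∑ₗ-zero : ∀ ms → ∑ₗ (λ _ → 0ℚ) ms ≡ 0ℚ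
    ∑ₗ-zero []       = refl
    ∑ₗ-zero (_ ∷ ms) = trans (cong (0ℚ +_) (∑ₗ-zero ms)) (ℚP.+-identityˡ 0ℚ)

  weightedHarary-mono-≤ : ∀ {V W : ℕ → ℚ} ns → (∀ m → V m ≤ W m) → weightedHarary V ns ≤ weightedHarary W ns
  weightedHarary-mono-≤ ns V≤W = ℚP.+-monoʳ-≤ (starHarary ns) (∑ₗ-mono-≤ ns V≤W)

  weightedHarary-∷ : ∀ W n ns → weightedHarary W (n ∷ ns) ≡
                     (pathHarary n + W n) + weightedHarary (λ m → W m + crossHarary n m) ns
  weightedHarary-∷ W n ns rewrite ∑ₗ-distrib-+ W (crossHarary n) ns =
    solve 5 (λ p h g w s → ((p :+ h) :+ g) :+ (w :+ s) := (p :+ w) :+ (h :+ (s :+ g))) refl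
      (pathHarary n) (starHarary ns) (∑ₗ (crossHarary n) ns) (W n) (∑ₗ W ns)

  weightedHarary-∷∷ : ∀ W a b ns → weightedHarary W (a ∷ b ∷ ns) ≡
    ((pathHarary a + pathHarary b + crossHarary a b) + (W a + W b))
      + weightedHarary (λ m → W m + crossHarary a m + crossHarary b m) ns
  weightedHarary-∷∷ W a b ns =
    trans (weightedHarary-∷ W a (b ∷ ns))
    (trans (cong (pathHarary a + W a +_) (weightedHarary-∷ (λ m → W m + crossHarary a m) b ns))
      (solve 6 (λ pa wa pb wb g r → (pa :+ wa) :+ ((pb :+ (wb :+ g)) :+ r) := ((pa :+ pb) :+ g) :+ (wa :+ wb) :+ r) refl
        (pathHarary a) (W a) (pathHarary b) (W b) (crossHarary a b)
        (weightedHarary (λ m → W m + crossHarary a m + crossHarary b m) ns)))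

  weightedHarary-swap : ∀ W a b ns → weightedHarary W (a ∷ b ∷ ns) ≡
                        (pathHarary b + W b) + weightedHarary (λ m → W m + crossHarary b m) (a ∷ ns)
  weightedHarary-swap W a b ns = begin
    weightedHarary W (a ∷ b ∷ ns)                                              ≡⟨ weightedHarary-∷∷ W a b ns ⟩
    ((pathHarary a + pathHarary b + crossHarary a b) + (W a + W b)) + weightedHarary (λ m → W m + Ga m + Gb m) ns
      ≡⟨ cong₂ (λ g r → ((pathHarary a + pathHarary b + g) + (W a + W b)) + r) (crossHarary-comm a b)
               (cong (starHarary ns +_) (∑ₗ-cong ns (λ m → ℚ+.xy∙z≈xz∙y (W m) (Ga m) (Gb m)))) ⟩
    ((pathHarary a + pathHarary b + crossHarary b a) + (W a + W b)) + weightedHarary (λ m → W m + Gb m + Ga m) ns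
      ≡⟨ solve 6 (λ pa pb g wa wb r → ((pa :+ pb :+ g) :+ (wa :+ wb)) :+ r := (pb :+ wb) :+ ((pa :+ (wa :+ g)) :+ r)) refl
                 (pathHarary a) (pathHarary b) (crossHarary b a) (W a) (W b) (weightedHarary (λ m → W m + Gb m + Ga m) ns) ⟩
    (pathHarary b + W b) + ((pathHarary a + (W a + Gb a)) + weightedHarary (λ m → W m + Gb m + Ga m) ns)
      ≡⟨ cong (pathHarary b + W b +_) (weightedHarary-∷ (λ m → W m + Gb m) a ns) ⟨
    (pathHarary b + W b) + weightedHarary (λ m → W m + crossHarary b m) (a ∷ ns)  ∎
    where
    open ≡-Reasoning
    Ga Gb : ℕ → ℚ
    Ga = crossHarary a
    Gb = crossHarary b

  transfer : ∀ W → Concave W → ∀ a b xs ys → b ℕ.≤ a →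
             weightedHarary W (suc a ∷ xs ++ b ∷ ys) ≤ weightedHarary W (a ∷ xs ++ suc b ∷ ys)
  transfer W W-concave a b [] ys b≤a =
    subst₂ _≤_ (sym (weightedHarary-∷∷ W (suc a) b ys)) (sym (weightedHarary-∷∷ W a (suc b) ys))
      (ℚP.+-mono-≤ (ℚP.+-mono-≤ (ℚP.≤-reflexive (pathHarary-exchange a b)) W-step)
                   (weightedHarary-mono-≤ ys cross-step))
    where
    W-step : W (suc a) + W b ≤ W a + W (suc b)
    W-step = subst (W (suc a) + W b ≤_) (ℚP.+-comm (W (suc b)) (W a)) (W-concave b a b≤a)
    cross-step : ∀ m → W m + crossHarary (suc a) m + crossHarary b m ≤ W m + crossHarary a m + crossHarary (suc b) m
    cross-step m = subst₂ _≤_ (sym (ℚP.+-assoc (W m) _ _)) (sym (ℚP.+-assoc (W m) _ _))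
      (ℚP.+-monoʳ-≤ (W m) (subst₂ _≤_
        (cong₂ _+_ (crossHarary-comm m (suc a)) (crossHarary-comm m b))
        (trans (ℚP.+-comm (crossHarary m (suc b)) (crossHarary m a)) (cong₂ _+_ (crossHarary-comm m a) (crossHarary-comm m (suc b))))
        (crossHarary-concave m b a b≤a)))
  transfer W W-concave a b (x ∷ xs) ys b≤a =
    subst₂ _≤_ (sym (weightedHarary-swap W (suc a) x (xs ++ b ∷ ys))) (sym (weightedHarary-swap W a x (xs ++ suc b ∷ ys)))
      (ℚP.+-monoʳ-≤ (pathHarary x + W x)
        (transfer (λ m → W m + crossHarary x m) (concave-+ {W} {crossHarary x} W-concave (crossHarary-concave x)) a b xs ys b≤a))

module Majorization where
  open import Data.Nat using (ℕ; zero; suc; _+_; _≤_; _<_; _≥_; z≤n)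
  import Data.Nat.Properties as ℕP
  open import Data.Nat.Solver using (module +-*-Solver)
  open import Data.List using (List; []; _∷_; _++_; length; take)
  open import Data.List.Relation.Unary.All using (All; []; _∷_)
  open import Data.List.Relation.Unary.AllPairs using (AllPairs; []; _∷_)
  open import Data.Nat.ListAction using () renaming (sum to sumL)
  import Data.Rational as ℚ
  import Data.Rational.Properties as ℚP
  open import Data.Product using (_×_; _,_; ∃-syntax)
  open import Data.Sum using (inj₁; inj₂)
  open import Relation.Binary.PropositionalEquality
  open +-*-Solver
  open StarHarary using (pathHarary; crossHarary)
  open Transfer

  prefix : ℕ → List ℕ → ℕ
  prefix i xs = sumL (take i xs)

  -- q together with d extra units majorizes p.
  record Majorizes+ (d : ℕ) (q p : List ℕ) : Set where
    constructor majorizes+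
    field
      length≡ : length q ≡ length p
      prefix≤ : ∀ i → prefix i p ≤ d + prefix i q
      sum≡    : sumL p ≡ d + sumL q

  majorizes+-∷⁻ : ∀ {d x k q p} → Majorizes+ d (x + k ∷ q) (x ∷ p) → Majorizes+ (d + k) q p
  majorizes+-∷⁻ {d} {x} {k} {q} {p} (majorizes+ len pre sum) =
    majorizes+ (ℕP.suc-injective len)
      (λ i → ℕP.+-cancelˡ-≤ x _ _ (ℕP.≤-trans (pre (suc i)) (ℕP.≤-reflexive (shift (prefix i q)))))
      (ℕP.+-cancelˡ-≡ x _ _ (trans sum (shift (sumL q))))
    where
    shift : ∀ t → d + (x + k + t) ≡ x + (d + k + t)
    shift = solve 4 (λ d x k t → d :+ (x :+ k :+ t) := x :+ (d :+ k :+ t)) refl d x k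

  majorizes+-∷⁺ : ∀ {d x k q p} → Majorizes+ (d + k) q p → Majorizes+ d (x + k ∷ q) (x ∷ p)
  majorizes+-∷⁺ {d} {x} {k} {q} {p} (majorizes+ len pre sum) =
    majorizes+ (cong suc len) pre′ (trans (cong (x +_) sum) (shift (sumL q)))
    where
    shift : ∀ t → x + (d + k + t) ≡ d + (x + k + t)
    shift = solve 4 (λ d x k t → x :+ (d :+ k :+ t) := d :+ (x :+ k :+ t)) refl d x k
    pre′ : ∀ i → prefix i (x ∷ p) ≤ d + prefix i (x + k ∷ q)
    pre′ zero    = z≤n
    pre′ (suc i) = ℕP.≤-trans (ℕP.+-monoʳ-≤ x (pre i)) (ℕP.≤-reflexive (shift (prefix i q)))

  majorizes+-shift : ∀ {d y q p} → Majorizes+ (suc d) (y ∷ q) p → Majorizes+ d (suc y ∷ q) p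
  majorizes+-shift {d} {y} {q} {p} (majorizes+ len pre sum) =
    majorizes+ len pre′ (trans sum (sym (ℕP.+-suc d (y + sumL q))))
    where
    pre′ : ∀ i → prefix i p ≤ d + prefix i (suc y ∷ q)
    pre′ zero    = z≤n
    pre′ (suc i) = ℕP.≤-trans (pre (suc i)) (ℕP.≤-reflexive (sym (ℕP.+-suc d (y + prefix i q))))

  majorizes+-raise : ∀ c {d} q p → All (_≤ c) p → Majorizes+ (suc d) q p →
                     ∃[ xs ] ∃[ b ] ∃[ ys ] q ≡ xs ++ b ∷ ys × b < c × Majorizes+ d (xs ++ suc b ∷ ys) p
  majorizes+-raise c []      []      _ (majorizes+ _ _ ())
  majorizes+-raise c (y ∷ q) (x ∷ p) (x≤c ∷ p≤c) m with ℕP.<-≤-connex y x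
  ... | inj₁ y<x = [] , y , q , refl , ℕP.<-≤-trans y<x x≤c , majorizes+-shift m
  ... | inj₂ x≤y with ℕP.m≤n⇒∃[o]m+o≡n x≤y
  ...   | k , refl with majorizes+-raise c q p p≤c (majorizes+-∷⁻ m)
  ...     | xs , b , ys , refl , b<c , m′ = x + k ∷ xs , b , ys , refl , b<c , majorizes+-∷⁺ m′

  mutual
    weightedHarary-antitone : ∀ W → Concave W → ∀ q p → AllPairs _≥_ p → Majorizes+ 0 q p →
                              weightedHarary W q ℚ.≤ weightedHarary W p
    weightedHarary-antitone W W-concave []      []      _ _ = ℚP.≤-refl
    weightedHarary-antitone W W-concave (y ∷ q) (x ∷ p) (p≤x ∷ p-sorted) m
      with ℕP.m≤n⇒∃[o]m+o≡n (ℕP.+-cancelʳ-≤ 0 x y (Majorizes+.prefix≤ m 1))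
    ... | d , refl = weightedHarary-antitone-∷ W W-concave x d q p p≤x p-sorted (majorizes+-∷⁻ m)

    weightedHarary-antitone-∷ : ∀ W → Concave W → ∀ x d q p → All (_≤ x) p → AllPairs _≥_ p →
                                Majorizes+ d q p → weightedHarary W (x + d ∷ q) ℚ.≤ weightedHarary W (x ∷ p)
    weightedHarary-antitone-∷ W W-concave x zero q p p≤x p-sorted m
      rewrite ℕP.+-identityʳ x | weightedHarary-∷ W x q | weightedHarary-∷ W x p =
      ℚP.+-monoʳ-≤ (pathHarary x ℚ.+ W x)
        (weightedHarary-antitone (λ m → W m ℚ.+ crossHarary x m)
          (concave-+ {W} {crossHarary x} W-concave (crossHarary-concave x)) q p p-sorted m)
    weightedHarary-antitone-∷ W W-concave x (suc d) q p p≤x p-sorted m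
      with majorizes+-raise x q p p≤x m
    ... | xs , b , ys , refl , b<x , m′ = ℚP.≤-trans
      (subst (λ t → weightedHarary W (t ∷ xs ++ b ∷ ys) ℚ.≤ weightedHarary W (x + d ∷ xs ++ suc b ∷ ys))
             (sym (ℕP.+-suc x d))
             (transfer W W-concave (x + d) b xs ys (ℕP.≤-trans (ℕP.<⇒≤ b<x) (ℕP.m≤m+n x d))))
      (weightedHarary-antitone-∷ W W-concave x d (xs ++ suc b ∷ ys) p p≤x p-sorted m′)

module VectorBridge where
  open import Defs
  open import Data.Nat as ℕ using (ℕ; zero; suc; _≤_; _≥_; z≤n; s≤s)
  import Data.Nat.Properties as ℕP
  open import Data.List as List using ([]; _∷_)
  import Data.List.Properties as ListP
  open import Data.List.Relation.Unary.All using (All; []; _∷_)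
  open import Data.List.Relation.Unary.AllPairs using (AllPairs; []; _∷_)
  open import Data.Nat.ListAction using () renaming (sum to sumL)
  open import Data.Vec as Vec using (Vec; []; _∷_; toList; lookup)
  open import Data.Vec.Properties using (length-toList)
  open import Data.Fin using () renaming (zero to fzero; suc to fsuc)
  open import Data.Rational using (0ℚ)
  open import Data.Product using (_,_)
  open import Function using (_∘_)
  open import Relation.Nullary using (yes; no)
  open import Relation.Binary.PropositionalEquality
  open Sums using (harary-∑; ∑-cong)
  open StarDistance using (starGraph; dist-starGraph)
  open StarHarary using (starHarary; treeHarary≡starHarary)
  open Transfer using (weightedHarary; weightedHarary-zero)
  open Majorization using (Majorizes+; majorizes+)

  sum-toList : ∀ {k} (v : Vec ℕ k) → Vec.sum v ≡ sumL (toList v)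
  sum-toList []      = refl
  sum-toList (x ∷ v) = cong (x ℕ.+_) (sum-toList v)

  S≡starGraph : ∀ {k} (ns : Vec ℕ k) → S ns ≡ starGraph (toList ns)
  S≡starGraph ns = cong (λ M → record { N = suc M ; adj = edgeAdj (starEdges 0 (toList ns)) }) (sum-toList ns)

  harary-starGraph : ∀ L → harary (starGraph L) ≡ starHarary L
  harary-starGraph L = trans (harary-∑ (starGraph L))
    (trans (∑-cong (N (starGraph L)) (λ y y<N → ∑-cong y (λ x x<y → cong inv (dist-starGraph L x y x<y y<N))))
           (treeHarary≡starHarary L))

  harary-S : ∀ {k} (ns : Vec ℕ k) → harary (S ns) ≡ weightedHarary (λ _ → 0ℚ) (toList ns)
  harary-S ns = begin
    harary (S ns)                           ≡⟨ cong harary (S≡starGraph ns) ⟩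
    harary (starGraph (toList ns))          ≡⟨ harary-starGraph (toList ns) ⟩
    starHarary (toList ns)                  ≡⟨ weightedHarary-zero (toList ns) ⟨
    weightedHarary (λ _ → 0ℚ) (toList ns)   ∎
    where open ≡-Reasoning

  nonincreasing⇒sorted : ∀ {k} (v : Vec ℕ k) → Nonincreasing v → AllPairs _≥_ (toList v)
  nonincreasing⇒sorted []      _        = []
  nonincreasing⇒sorted (x ∷ v) v-nonincr =
    below-head v (λ j → v-nonincr fzero (fsuc j) z≤n) ∷ nonincreasing⇒sorted v (λ i j i≤j → v-nonincr (fsuc i) (fsuc j) (s≤s i≤j))
    where
    below-head : ∀ {k} (v : Vec ℕ k) → (∀ j → lookup v j ≤ x) → All (_≤ x) (toList v)
    below-head []      _   = []
    below-head (y ∷ v) v≤x = v≤x fzero ∷ below-head v (v≤x ∘ fsuc)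

  ≺⇒majorizes+ : ∀ {k} (p q : Vec ℕ k) → p ≺ q → Majorizes+ 0 (toList q) (toList p)
  ≺⇒majorizes+ {k} p q (_ , _ , prefix≤ , sum≡) =
    majorizes+ (trans (length-toList q) (sym (length-toList p))) pre
      (trans (sym (sum-toList p)) (trans (sym sum≡) (sum-toList q)))
    where
    pre : ∀ i → Majorization.prefix i (toList p) ≤ Majorization.prefix i (toList q)
    pre zero = z≤n
    pre (suc i) with suc i ℕ.<? k
    ... | yes i<k = prefix≤ (suc i) (s≤s z≤n) i<k
    ... | no  i≮k = ℕP.≤-reflexive (begin
      sumL (List.take (suc i) (toList p))  ≡⟨ cong sumL (ListP.take-all (suc i) (toList p) (long p)) ⟩
      sumL (toList p)                      ≡⟨ sum-toList p ⟨
      Vec.sum p                            ≡⟨ sum≡ ⟨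
      Vec.sum q                            ≡⟨ sum-toList q ⟩
      sumL (toList q)                      ≡⟨ cong sumL (ListP.take-all (suc i) (toList q) (long q)) ⟨
      sumL (List.take (suc i) (toList q))  ∎)
      where
      open ≡-Reasoning
      long : (v : Vec ℕ k) → suc i ≥ List.length (toList v)
      long v = subst (suc i ≥_) (sym (length-toList v)) (ℕP.≮⇒≥ i≮k)

open import Defs
open import Data.Nat using (ℕ; _≤_; _<_)
open import Data.Vec using (Vec; lookup; toList)
open import Data.Fin using (Fin)
open import Data.Rational as ℚ using (_≥_; 0ℚ)
open import Data.Product using (_,_)
open import Relation.Binary.PropositionalEquality using (subst₂; sym)
open VectorBridge
open Transfer using (concave-zero)
open Majorization using (weightedHarary-antitone)

-- Neither k ≥ 2 nor the positivity of the entries is needed.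
theorem2p5 : (k : ℕ) → 2 ≤ k → (p q : Vec ℕ k) →
    ((i : Fin k) → 0 < lookup p i) → ((i : Fin k) → 0 < lookup q i) →
    p ≺ q → harary (S p) ≥ harary (S q)
theorem2p5 k _ p q _ _ p≺q@(_ , p-nonincreasing , _) =
  subst₂ ℚ._≤_ (sym (harary-S q)) (sym (harary-S p))
    (weightedHarary-antitone (λ _ → 0ℚ) concave-zero (toList q) (toList p)
      (nonincreasing⇒sorted p p-nonincreasing) (≺⇒majorizes+ p q p≺q))
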